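{- Let $D_{25}$ be the digraph with vertex set $\{u_{i,j} : i,j\in\{1,\dots,5\}\}$ and arc set $\{u_{i,j}u_{i+1,j'} : i,j,j'\in\{1,\dots,5\},\ j\ne j'\}\cup\{u_{i+1,j}u_{i,j} : i,j\in\{1,\dots,5\}\}$, indices $i$ read modulo $5$ (this is the $5$-backward-blowup of the directed $5$-cycle). Then $D_{25}$ is a $3$-dicritical oriented triangle-free graph on $25$ vertices.
   Context: An oriented triangle-free graph is an oriented graph whose underlying undirected graph contains no triangle. The dichromatic number of a digraph is the least $k$ such that its vertex set can be partitioned into $k$ sets each inducing a subdigraph with no directed cycle. A digraph is $3$-dicritical if its dichromatic number is $3$ and every proper subdigraph (in particular, the digraph minus any vertex or minus any arc) has dichromatic number at most $2$. -}

module Defs where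

open import Level using (Level; 0ℓ)
open import Data.Nat using (ℕ; zero; suc; pred)
open import Data.Nat.DivMod using (_mod_)
open import Data.Fin using (Fin; toℕ)
open import Data.Product using (Σ; _×_; ∃-syntax)
open import Data.Sum using (_⊎_)
open import Relation.Nullary using (¬_)
open import Relation.Binary.PropositionalEquality using (_≡_)
open import Function.Definitions using (Injective)

record Digraph : Set₁ where
  field
    V   : Set
    Arc : V → V → Set
open Digraph public

nextMod : {k : ℕ} → Fin (suc k) → Fin (suc k)
nextMod {k} i = suc (toℕ i) mod (suc k)

record DirCycle (D : Digraph) : Set where
  field
    len-1 : ℕ
    vert  : Fin (suc len-1) → V D
    inj   : Injective _≡_ _≡_ vert
    arcs  : (i : Fin (suc len-1)) → Arc D (vert i) (vert (nextMod i))
open DirCycle public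

Acyclic : Digraph → Set
Acyclic D = ¬ DirCycle D

Induced : (D : Digraph) → (V D → Set) → Digraph
Induced D S = record
  { V = Σ (V D) S
  ; Arc = λ u v → Arc D (Data.Product.proj₁ u) (Data.Product.proj₁ v) }

Dicolourable : ℕ → Digraph → Set
Dicolourable k D =
  Σ (V D → Fin k) λ f → (c : Fin k) → Acyclic (Induced D (λ v → f v ≡ c))

DichromaticNumberIs : ℕ → Digraph → Set
DichromaticNumberIs zero D = Dicolourable zero D
DichromaticNumberIs (suc k) D = Dicolourable (suc k) D × ¬ Dicolourable k D

record Subdigraph (D : Digraph) : Set₁ where
  field
    keepV : V D → Set
    keepA : V D → V D → Set
    keepA⊆ : ∀ {u v} → keepA u v → Arc D u v × keepV u × keepV v
open Subdigraph public

Proper : {D : Digraph} → Subdigraph D → Set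
Proper {D} H =
  (∃[ v ] ¬ keepV H v) ⊎ (∃[ u ] ∃[ v ] (Arc D u v × ¬ keepA H u v))

asDigraph : {D : Digraph} → Subdigraph D → Digraph
asDigraph {D} H = record
  { V = Σ (V D) (keepV H)
  ; Arc = λ u v → keepA H (Data.Product.proj₁ u) (Data.Product.proj₁ v) }

Dicritical : ℕ → Digraph → Set₁
Dicritical k D =
  DichromaticNumberIs k D × ((H : Subdigraph D) → Proper H → Dicolourable (pred k) (asDigraph H))

Oriented : Digraph → Set
Oriented D = (∀ v → ¬ Arc D v v) × (∀ u v → Arc D u v → ¬ Arc D v u)

Adj : (D : Digraph) → V D → V D → Set
Adj D u v = Arc D u v ⊎ Arc D v u

TriangleFree : Digraph → Set
TriangleFree D = ∀ x y z → ¬ x ≡ y → ¬ y ≡ z → ¬ x ≡ z →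
  ¬ (Adj D x y × Adj D y z × Adj D x z)

-- D₂₅: vertices u_{i,j}, i j ∈ Fin 5 (index 0..4 standing for 1..5), i mod 5
D25 : Digraph
D25 = record
  { V = Fin 5 × Fin 5
  ; Arc = λ u v →
      (Data.Product.proj₁ v ≡ nextMod (Data.Product.proj₁ u) × ¬ Data.Product.proj₂ u ≡ Data.Product.proj₂ v)
      ⊎ (Data.Product.proj₁ u ≡ nextMod (Data.Product.proj₁ v) × Data.Product.proj₂ u ≡ Data.Product.proj₂ v) }

-- Each dicolouring is certified by ranks that strictly increase along monochromatic arcs, so
-- that its colour classes are acyclic.  Rotating the five layers and permuting the five columns
-- are automorphisms of D₂₅, and they act transitively on the forward arcs u_{i,j} u_{i+1,j′} and
-- on the backward arcs u_{i+1,j} u_{i,j}.  One 2-colouring has as its only monochromatic directed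
-- cycle the 4-cycle u₀₀ u₁₁ u₀₁ u₁₀, which contains arcs of both kinds; hence D₂₅ minus any arc
-- is 2-dicolourable, and so is every proper subdigraph, since deleting a vertex deletes its
-- out-arcs.  That D₂₅ itself is not 2-dicolourable is an exhaustive search over 2-colourings,
-- each branch closed by a monochromatic directed 4- or 5-cycle.  Adjacent vertices lie in
-- consecutive layers, and the layers form a 5-cycle, which has no triangle.
module Submission where

open import Defs
open import Data.Bool using (Bool; false; T; _∧_; _∨_)
open import Data.Bool.Properties using (T-∧; T-∨)
open import Data.Fin using (Fin; zero; suc; toℕ; fromℕ<; _≟_; #_)
open import Data.Fin.Permutation using (Permutation′; _⟨$⟩ʳ_; _∘ₚ_; transpose)
open import Data.Fin.Properties using (toℕ-injective; toℕ-fromℕ<; all?; any?)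
open import Data.List using (List; []; _∷_)
import Data.List.Relation.Unary.Any as Any
open import Data.Maybe using (Maybe; just; nothing)
import Data.Maybe.Properties as Maybe
open import Data.Nat using (ℕ; zero; suc; _+_; _∸_; _≤_; _<_; _<?_; _%_; s≤s)
open import Data.Nat.DivMod using (_mod_; m<n⇒m%n≡m; n%n≡0)
open import Data.Nat.Properties
  using (≤-reflexive; +-identityʳ; +-suc; n<1+n; <-trans; ≤-<-trans; m+n≮m; module ≤-Reasoning)
open import Data.Product using (∃; ∃-syntax; _×_; _,_; proj₁; proj₂)
open import Data.Product.Properties using (≡-dec)
open import Data.Sum using (_⊎_; inj₁; inj₂)
open import Data.Vec using (Vec; _∷_; []; lookup; replicate; updateAt; _[_]≔_)
open import Data.Vec.Properties
  using (lookup∘updateAt; lookup∘updateAt′; lookup∘update; lookup∘update′; lookup-replicate)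
open import Function.Base using (case_of_)
open import Function.Bundles using (Injection; Equivalence)
open import Function.Definitions using (Injective)
open import Function.Properties.Inverse using (↔⇒↣)
open import Relation.Binary.Definitions using (Decidable; DecidableEquality)
open import Relation.Binary.PropositionalEquality
  using (_≡_; refl; cong; cong₂; sym; trans; subst; module ≡-Reasoning)
open import Relation.Nullary using (Dec; yes; no; ¬_; ¬?)
open import Relation.Nullary.Decidable
  using (True; isYes; toWitness; from-yes; map′; _×-dec_; _⊎-dec_; _→-dec_)

nextMod-fromℕ< : ∀ {k m} (p : m < suc k) (q : suc m < suc k) → nextMod (fromℕ< p) ≡ fromℕ< q
nextMod-fromℕ< {k} p q = toℕ-injective (begin
  toℕ (nextMod (fromℕ< p))      ≡⟨ toℕ-fromℕ< _ ⟩
  suc (toℕ (fromℕ< p)) % suc k  ≡⟨ cong (λ m → suc m % suc k) (toℕ-fromℕ< p) ⟩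
  suc _ % suc k                 ≡⟨ m<n⇒m%n≡m q ⟩
  suc _                         ≡⟨ sym (toℕ-fromℕ< q) ⟩
  toℕ (fromℕ< q)                ∎)
  where open ≡-Reasoning

nextMod-last : ∀ {k} → nextMod (fromℕ< (n<1+n k)) ≡ zero
nextMod-last {k} = toℕ-injective (begin
  toℕ (nextMod (fromℕ< (n<1+n k)))      ≡⟨ toℕ-fromℕ< _ ⟩
  suc (toℕ (fromℕ< (n<1+n k))) % suc k  ≡⟨ cong (λ m → suc m % suc k) (toℕ-fromℕ< (n<1+n k)) ⟩
  suc k % suc k                         ≡⟨ n%n≡0 (suc k) ⟩
  zero                                  ∎)
  where open ≡-Reasoning

ranked⇒acyclic : (D : Digraph) (r : V D → ℕ) → (∀ {x y} → Arc D x y → r x < r y) → Acyclic D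
ranked⇒acyclic D r ascends C = m+n≮m (ρ zero) k (≤-<-trans (climb k last<) wrap-around)
  where
  k = len-1 C
  last< = n<1+n k
  ρ : Fin (suc k) → ℕ
  ρ i = r (vert C i)
  open ≤-Reasoning
  climb : ∀ m (p : m < suc k) → ρ zero + m ≤ ρ (fromℕ< p)
  climb zero    p = ≤-reflexive (+-identityʳ (ρ zero))
  climb (suc m) p = begin
    ρ zero + suc m           ≡⟨ +-suc (ρ zero) m ⟩
    suc (ρ zero + m)         ≤⟨ s≤s (climb m p′) ⟩
    suc (ρ (fromℕ< p′))      ≤⟨ ascends (arcs C (fromℕ< p′)) ⟩
    ρ (nextMod (fromℕ< p′))  ≡⟨ cong ρ (nextMod-fromℕ< p′ p) ⟩
    ρ (fromℕ< p)             ∎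
    where p′ = <-trans (n<1+n m) p
  wrap-around : ρ (fromℕ< last<) < ρ zero
  wrap-around = subst (ρ (fromℕ< last<) <_) (cong ρ nextMod-last) (ascends (arcs C (fromℕ< last<)))

Monochromatic : {D : Digraph} {A : Set} → (V D → A) → DirCycle D → Set
Monochromatic f C = ∀ i → f (vert C i) ≡ f (vert C zero)

monochromatic⇒¬dicolouring : ∀ {k D} (f : V D → Fin k) (C : DirCycle D) → Monochromatic f C →
  ¬ ((c : Fin k) → Acyclic (Induced D (λ v → f v ≡ c)))
monochromatic⇒¬dicolouring f C mono acyclic = acyclic (f (vert C zero)) record
  { len-1 = len-1 C
  ; vert  = λ i → vert C i , mono i
  ; inj   = λ eq → inj C (cong proj₁ eq)
  ; arcs  = arcs C
  }

record RankedColouring (k : ℕ) (D : Digraph) : Set where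
  field
    colour  : V D → Fin k
    rank    : V D → ℕ
    ascends : ∀ {x y} → Arc D x y → colour x ≡ colour y → rank x < rank y
open RankedColouring

ranked⇒dicolourable : ∀ {k D} → RankedColouring k D → Dicolourable k D
ranked⇒dicolourable R = colour R , λ c → ranked⇒acyclic _ (λ v → rank R (proj₁ v))
  λ {(_ , x≡c)} {(_ , y≡c)} a → ascends R a (trans x≡c (sym y≡c))

record Homomorphism (E D : Digraph) : Set where
  field
    map            : V E → V D
    preserves-arcs : ∀ {x y} → Arc E x y → Arc D (map x) (map y)
open Homomorphism

pullback : ∀ {k E D} → Homomorphism E D → RankedColouring k D → RankedColouring k E
pullback φ R = record
  { colour  = λ x → colour R (map φ x)
  ; rank    = λ x → rank R (map φ x)
  ; ascends = λ a → ascends R (preserves-arcs φ a)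
  }

deleteArc : (D : Digraph) → V D → V D → Digraph
deleteArc D v w = record { V = V D ; Arc = λ x y → Arc D x y × ¬ (x ≡ v × y ≡ w) }

deleteArc-homomorphism : ∀ {E D v w} (φ : Homomorphism E D) → Injective _≡_ _≡_ (map φ) →
  Homomorphism (deleteArc E v w) (deleteArc D (map φ v) (map φ w))
deleteArc-homomorphism φ injective = record
  { map            = map φ
  ; preserves-arcs = λ (a , a≢vw) → preserves-arcs φ a , λ (x≡ , y≡) → a≢vw (injective x≡ , injective y≡)
  }

proper⇒into-deleteArc : ∀ {D} → (∀ v → ∃ (Arc D v)) → (H : Subdigraph D) → Proper H →
  ∃[ v ] ∃[ w ] Arc D v w × Homomorphism (asDigraph H) (deleteArc D v w)
proper⇒into-deleteArc out H (inj₁ (v , v∉H)) = v , proj₁ (out v) , proj₂ (out v) , record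
  { map            = proj₁
  ; preserves-arcs = λ a → let (a′ , x∈H , _) = keepA⊆ H a in a′ , λ { (refl , _) → v∉H x∈H }
  }
proper⇒into-deleteArc out H (inj₂ (v , w , a , vw∉H)) = v , w , a , record
  { map            = proj₁
  ; preserves-arcs = λ a′ → proj₁ (keepA⊆ H a′) , λ { (refl , refl) → vw∉H a′ }
  }

proper-subdigraphs-dicolourable : ∀ {k D} → (∀ v → ∃ (Arc D v)) →
  (∀ {v w} → Arc D v w → RankedColouring k (deleteArc D v w)) →
  (H : Subdigraph D) → Proper H → Dicolourable k (asDigraph H)
proper-subdigraphs-dicolourable out colouring-without H proper =
  let (_ , _ , a , φ) = proper⇒into-deleteArc out H proper
  in ranked⇒dicolourable (pullback φ (colouring-without a))

Vertex : Set
Vertex = Fin 5 × Fin 5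

u : ℕ → ℕ → Vertex
u i j = i mod 5 , j mod 5

_≟ᵥ_ : DecidableEquality Vertex
_≟ᵥ_ = ≡-dec _≟_ _≟_

arc? : Decidable (Arc D25)
arc? (i , j) (i′ , j′) = (i′ ≟ nextMod i ×-dec ¬? (j ≟ j′)) ⊎-dec (i ≟ nextMod i′ ×-dec j ≟ j′)

every-vertex? : {P : Vertex → Set} → (∀ v → Dec (P v)) → Dec (∀ v → P v)
every-vertex? P? = map′ (λ h (i , j) → h i j) (λ h i j → h (i , j)) (all? λ i → all? λ j → P? (i , j))

some-vertex? : {P : Vertex → Set} → (∀ v → Dec (P v)) → Dec (∃ P)
some-vertex? P? =
  map′ (λ (i , j , p) → (i , j) , p) (λ ((i , j) , p) → i , j , p) (any? λ i → any? λ j → P? (i , j))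

out-arc : ∀ v → ∃ (Arc D25 v)
out-arc = from-yes (every-vertex? λ v → some-vertex? λ w → arc? v w)

Consecutive : Fin 5 → Fin 5 → Set
Consecutive i i′ = i′ ≡ nextMod i ⊎ i ≡ nextMod i′

consecutive? : Decidable Consecutive
consecutive? i i′ = (i′ ≟ nextMod i) ⊎-dec (i ≟ nextMod i′)

adjacent⇒consecutive : ∀ {x y} → Adj D25 x y → Consecutive (proj₁ x) (proj₁ y)
adjacent⇒consecutive (inj₁ (inj₁ (e , _))) = inj₁ e
adjacent⇒consecutive (inj₁ (inj₂ (e , _))) = inj₂ e
adjacent⇒consecutive (inj₂ (inj₁ (e , _))) = inj₂ e
adjacent⇒consecutive (inj₂ (inj₂ (e , _))) = inj₁ e

¬consecutive-self : ∀ i → ¬ Consecutive i i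
¬consecutive-self = from-yes (all? λ i → ¬? (consecutive? i i))

¬consecutive-triangle : ∀ a b c → ¬ (Consecutive a b × Consecutive b c × Consecutive a c)
¬consecutive-triangle = from-yes (all? λ a → all? λ b → all? λ c →
  ¬? (consecutive? a b ×-dec consecutive? b c ×-dec consecutive? a c))

oriented : Oriented D25
oriented = (λ v a → ¬consecutive-self (proj₁ v) (adjacent⇒consecutive (inj₁ a)))
         , from-yes (every-vertex? λ x → every-vertex? λ y → arc? x y →-dec ¬? (arc? y x))

triangle-free : TriangleFree D25
triangle-free x y z _ _ _ (xy , yz , xz) = ¬consecutive-triangle _ _ _
  (adjacent⇒consecutive xy , adjacent⇒consecutive yz , adjacent⇒consecutive xz)

-- Ranked colourings of D₂₅ and of D₂₅ minus an arc

table : {A : Set} → Vec (Vec A 5) 5 → Vertex → A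
table rows (i , j) = lookup (lookup rows i) j

ranked-by-exhaustion : ∀ {k} (A : Vertex → Vertex → Set) (A? : Decidable A)
  (c : Vertex → Fin k) (r : Vertex → ℕ) →
  {True (every-vertex? λ x → every-vertex? λ y → A? x y →-dec c x ≟ c y →-dec r x <? r y)} →
  RankedColouring k record { V = Vertex ; Arc = A }
ranked-by-exhaustion A A? c r {ok} = record { colour = c ; rank = r ; ascends = λ {x} {y} → toWitness ok x y }

three-colouring : RankedColouring 3 D25
three-colouring = ranked-by-exhaustion (Arc D25) arc? (table colours) (table ranks)
  where
  colours : Vec (Vec (Fin 3) 5) 5
  colours = (# 0 ∷ # 0 ∷ # 0 ∷ # 0 ∷ # 0 ∷ [])
          ∷ (# 0 ∷ # 1 ∷ # 1 ∷ # 1 ∷ # 1 ∷ [])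
          ∷ (# 0 ∷ # 1 ∷ # 2 ∷ # 2 ∷ # 2 ∷ [])
          ∷ (# 0 ∷ # 0 ∷ # 0 ∷ # 0 ∷ # 0 ∷ [])
          ∷ (# 1 ∷ # 0 ∷ # 1 ∷ # 1 ∷ # 1 ∷ [])
          ∷ []
  ranks : Vec (Vec ℕ 5) 5
  ranks = (6 ∷ 0 ∷ 4 ∷ 4 ∷ 4 ∷ [])
        ∷ (5 ∷ 2 ∷ 0 ∷ 0 ∷ 0 ∷ [])
        ∷ (1 ∷ 1 ∷ 0 ∷ 0 ∷ 0 ∷ [])
        ∷ (0 ∷ 4 ∷ 2 ∷ 2 ∷ 2 ∷ [])
        ∷ (0 ∷ 3 ∷ 0 ∷ 0 ∷ 0 ∷ [])
        ∷ []

relabel : (Fin 5 → Fin 5) → Permutation′ 5 → Vertex → Vertex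
relabel ρ σ (i , j) = ρ i , σ ⟨$⟩ʳ j

relabel-homomorphism : ∀ ρ σ → (∀ i → ρ (nextMod i) ≡ nextMod (ρ i)) → Homomorphism D25 D25
relabel-homomorphism ρ σ ρ-nextMod = record
  { map            = relabel ρ σ
  ; preserves-arcs = λ
    { {i , _}      (inj₁ (refl , j≢j′)) → inj₁ (ρ-nextMod i , λ eq → j≢j′ (Injection.injective (↔⇒↣ σ) eq))
    ; {_} {i′ , _} (inj₂ (refl , refl)) → inj₂ (ρ-nextMod i′ , refl)
    }
  }

relabel-injective : ∀ {ρ} σ → Injective _≡_ _≡_ ρ → Injective _≡_ _≡_ (relabel ρ σ)
relabel-injective σ ρ-injective eq =
  cong₂ _,_ (ρ-injective (cong proj₁ eq)) (Injection.injective (↔⇒↣ σ) (cong proj₂ eq))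

relabel-without-arc : ∀ {v w v₀ w₀} ρ σ → (∀ i → ρ (nextMod i) ≡ nextMod (ρ i)) → Injective _≡_ _≡_ ρ →
  relabel ρ σ v ≡ v₀ → relabel ρ σ w ≡ w₀ →
  RankedColouring 2 (deleteArc D25 v₀ w₀) → RankedColouring 2 (deleteArc D25 v w)
relabel-without-arc ρ σ ρ-nextMod ρ-injective refl refl = pullback
  (deleteArc-homomorphism (relabel-homomorphism ρ σ ρ-nextMod) (relabel-injective σ ρ-injective))

rotate : Fin 5 → Fin 5 → Fin 5
rotate a i = (toℕ i + (5 ∸ toℕ a)) mod 5

rotate-nextMod : ∀ a i → rotate a (nextMod i) ≡ nextMod (rotate a i)
rotate-nextMod = from-yes (all? λ a → all? λ i → rotate a (nextMod i) ≟ nextMod (rotate a i))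

rotate-injective : ∀ a → Injective _≡_ _≡_ (rotate a)
rotate-injective a {i} {i′} =
  from-yes (all? λ a → all? λ i → all? λ i′ → rotate a i ≟ rotate a i′ →-dec i ≟ i′) a i i′

rotate-self : ∀ a → rotate a a ≡ zero
rotate-self = from-yes (all? λ a → rotate a a ≟ zero)

rotate-successor : ∀ a → rotate a (nextMod a) ≡ suc zero
rotate-successor a = trans (rotate-nextMod a a) (cong nextMod (rotate-self a))

to-front : Fin 5 → Permutation′ 5
to-front j = transpose zero j

to-front-self : ∀ j → to-front j ⟨$⟩ʳ j ≡ zero
to-front-self = from-yes (all? λ j → to-front j ⟨$⟩ʳ j ≟ zero)

two-to-front : Fin 5 → Fin 5 → Permutation′ 5
two-to-front j j′ = to-front j ∘ₚ transpose (suc zero) (to-front j ⟨$⟩ʳ j′)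

two-to-front-fst : ∀ j j′ → ¬ j ≡ j′ → two-to-front j j′ ⟨$⟩ʳ j ≡ zero
two-to-front-fst = from-yes (all? λ j → all? λ j′ →
  ¬? (j ≟ j′) →-dec two-to-front j j′ ⟨$⟩ʳ j ≟ zero)

two-to-front-snd : ∀ j j′ → ¬ j ≡ j′ → two-to-front j j′ ⟨$⟩ʳ j′ ≡ suc zero
two-to-front-snd = from-yes (all? λ j → all? λ j′ →
  ¬? (j ≟ j′) →-dec two-to-front j j′ ⟨$⟩ʳ j′ ≟ suc zero)

base-colouring : Vertex → Fin 2
base-colouring = table
  ( (# 0 ∷ # 0 ∷ # 0 ∷ # 0 ∷ # 0 ∷ [])
  ∷ (# 0 ∷ # 0 ∷ # 1 ∷ # 1 ∷ # 1 ∷ [])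
  ∷ (# 1 ∷ # 1 ∷ # 0 ∷ # 0 ∷ # 1 ∷ [])
  ∷ (# 0 ∷ # 0 ∷ # 0 ∷ # 1 ∷ # 0 ∷ [])
  ∷ (# 1 ∷ # 1 ∷ # 1 ∷ # 1 ∷ # 1 ∷ [])
  ∷ [])

without-forward-arc : RankedColouring 2 (deleteArc D25 (u 0 0) (u 1 1))
without-forward-arc =
  ranked-by-exhaustion _ (λ x y → arc? x y ×-dec ¬? (x ≟ᵥ u 0 0 ×-dec y ≟ᵥ u 1 1)) base-colouring (table
    ( (4 ∷ 2 ∷ 0 ∷ 0 ∷ 0 ∷ [])
    ∷ (3 ∷ 1 ∷ 0 ∷ 0 ∷ 2 ∷ [])
    ∷ (3 ∷ 3 ∷ 6 ∷ 4 ∷ 1 ∷ [])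
    ∷ (7 ∷ 7 ∷ 5 ∷ 4 ∷ 7 ∷ [])
    ∷ (5 ∷ 5 ∷ 5 ∷ 0 ∷ 5 ∷ [])
    ∷ []))

without-backward-arc : RankedColouring 2 (deleteArc D25 (u 1 0) (u 0 0))
without-backward-arc =
  ranked-by-exhaustion _ (λ x y → arc? x y ×-dec ¬? (x ≟ᵥ u 1 0 ×-dec y ≟ᵥ u 0 0)) base-colouring (table
    ( (0 ∷ 2 ∷ 0 ∷ 0 ∷ 0 ∷ [])
    ∷ (3 ∷ 1 ∷ 0 ∷ 0 ∷ 2 ∷ [])
    ∷ (3 ∷ 3 ∷ 6 ∷ 4 ∷ 1 ∷ [])
    ∷ (7 ∷ 7 ∷ 5 ∷ 4 ∷ 7 ∷ [])
    ∷ (5 ∷ 5 ∷ 5 ∷ 0 ∷ 5 ∷ [])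
    ∷ []))

colouring-without-arc : ∀ {v w} → Arc D25 v w → RankedColouring 2 (deleteArc D25 v w)
colouring-without-arc {a , j} {_ , j′} (inj₁ (refl , j≢j′)) =
  relabel-without-arc (rotate a) (two-to-front j j′) (rotate-nextMod a) (rotate-injective a)
    (cong₂ _,_ (rotate-self a) (two-to-front-fst j j′ j≢j′))
    (cong₂ _,_ (rotate-successor a) (two-to-front-snd j j′ j≢j′))
    without-forward-arc
colouring-without-arc {_ , j} {a , _} (inj₂ (refl , refl)) =
  relabel-without-arc (rotate a) (to-front j) (rotate-nextMod a) (rotate-injective a)
    (cong₂ _,_ (rotate-successor a) (to-front-self j))
    (cong₂ _,_ (rotate-self a) (to-front-self j))
    without-backward-arc

-- D₂₅ is not 2-dicolourable

IsCycle : ∀ {k} → Vec Vertex (suc k) → Set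
IsCycle c = (∀ i → Arc D25 (lookup c i) (lookup c (nextMod i))) × (∀ i j → lookup c i ≡ lookup c j → i ≡ j)

isCycle? : ∀ {k} (c : Vec Vertex (suc k)) → Dec (IsCycle c)
isCycle? c = all? (λ i → arc? (lookup c i) (lookup c (nextMod i)))
       ×-dec all? (λ i → all? λ j → lookup c i ≟ᵥ lookup c j →-dec i ≟ j)

cycle : ∀ {k} (c : Vec Vertex (suc k)) → {True (isCycle? c)} → DirCycle D25
cycle c {ok} = record
  { len-1 = _
  ; vert  = lookup c
  ; inj   = λ {i} {j} → proj₂ (toWitness ok) i j
  ; arcs  = proj₁ (toWitness ok)
  }

Partial : Set
Partial = Vec (Vec (Maybe (Fin 2)) 5) 5

unassigned : Partial
unassigned = replicate 5 (replicate 5 nothing)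

assign : Partial → Vertex → Fin 2 → Partial
assign s (i , j) b = updateAt s i (λ row → row [ j ]≔ just b)

unassigned-nothing : ∀ v → table unassigned v ≡ nothing
unassigned-nothing (i , j) =
  trans (cong (λ row → lookup row j) (lookup-replicate i _)) (lookup-replicate j nothing)

assign-same : ∀ s q b → table (assign s q b) q ≡ just b
assign-same s (i , j) b =
  trans (cong (λ row → lookup row j) (lookup∘updateAt i s)) (lookup∘update j (lookup s i) (just b))

assign-other : ∀ s {v q} b → ¬ v ≡ q → table (assign s q b) v ≡ table s v
assign-other s {i′ , j′} {i , j} b v≢q with i′ ≟ i
... | yes refl = trans (cong (λ row → lookup row j′) (lookup∘updateAt i s))
                       (lookup∘update′ (λ j′≡j → v≢q (cong (i ,_) j′≡j)) (lookup s i) (just b))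
... | no i′≢i  = cong (λ row → lookup row j′) (lookup∘updateAt′ i′ i i′≢i s)

Extends : Partial → (Vertex → Fin 2) → Set
Extends s f = ∀ v {b} → table s v ≡ just b → f v ≡ b

extends-unassigned : ∀ f → Extends unassigned f
extends-unassigned f v eq = case trans (sym (unassigned-nothing v)) eq of λ ()

extends-assign : ∀ {s f} q → Extends s f → Extends (assign s q (f q)) f
extends-assign {s} {f} q ext v with v ≟ᵥ q
... | yes refl = λ eq → Maybe.just-injective (trans (sym (assign-same s q (f q))) eq)
... | no v≢q   = λ eq → ext v (trans (sym (assign-other s (f q) v≢q)) eq)

MonochromaticUnder : Partial → DirCycle D25 → Set
MonochromaticUnder s C = ∃ λ b → ∀ i → table s (vert C i) ≡ just b

monochromaticUnder? : ∀ s C → Dec (MonochromaticUnder s C)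
monochromaticUnder? s C = any? λ b → all? λ i → Maybe.≡-dec _≟_ (table s (vert C i)) (just b)

monochromatic-extends : ∀ {s f C} → Extends s f → MonochromaticUnder s C → Monochromatic f C
monochromatic-extends ext (b , mono) i = trans (ext _ (mono i)) (sym (ext _ (mono zero)))

Plan : Set
Plan = List (Vertex × List (DirCycle D25))

both : (Fin 2 → Bool) → Bool
both P = P zero ∧ P (suc zero)

both-sound : ∀ P → T (both P) → ∀ b → T (P b)
both-sound P ok zero       = proj₁ (Equivalence.to T-∧ ok)
both-sound P ok (suc zero) = proj₂ (Equivalence.to T-∧ ok)

-- Colour the vertices of the plan in order; after colouring q, either one of the cycles listed
-- with q is already monochromatic or the search goes on with the rest of the plan.
refutes : Plan → Partial → Bool
closes-or-refutes : List (DirCycle D25) → Plan → Partial → Bool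

refutes []                s = false
refutes ((q , cs) ∷ plan) s = both λ b → closes-or-refutes cs plan (assign s q b)

closes-or-refutes cs plan s = isYes (Any.any? (monochromaticUnder? s) cs) ∨ refutes plan s

refutes-sound : ∀ plan s → T (refutes plan s) → ∀ f → Extends s f → ∃ λ C → Monochromatic f C
closes-or-refutes-sound : ∀ cs plan s → T (closes-or-refutes cs plan s) →
  ∀ f → Extends s f → ∃ λ C → Monochromatic f C

refutes-sound ((q , cs) ∷ plan) s ok f ext =
  closes-or-refutes-sound cs plan (assign s q (f q)) (both-sound branch ok (f q)) f (extends-assign {s} q ext)
  where branch = λ b → closes-or-refutes cs plan (assign s q b)

closes-or-refutes-sound cs plan s ok f ext with Equivalence.to T-∨ ok
... | inj₁ closes  = let (C , mono) = Any.satisfied (toWitness closes)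
                     in C , monochromatic-extends {s} {C = C} ext mono
... | inj₂ refuted = refutes-sound plan s refuted f ext

-- Found by a computer search; it closes 8752 branches.
plan : Plan
plan =
  (u 0 0 , []) ∷
  (u 1 0 , []) ∷
  (u 2 0 , []) ∷
  (u 3 0 , []) ∷
  (u 4 0 , cycle (u 0 0 ∷ u 4 0 ∷ u 3 0 ∷ u 2 0 ∷ u 1 0 ∷ []) ∷ []) ∷
  (u 0 1 , cycle (u 0 0 ∷ u 4 0 ∷ u 0 1 ∷ u 1 0 ∷ []) ∷ []) ∷
  (u 1 1 , cycle (u 0 0 ∷ u 1 1 ∷ u 2 0 ∷ u 1 0 ∷ []) ∷ cycle (u 0 0 ∷ u 1 1 ∷ u 0 1 ∷ u 1 0 ∷ []) ∷ []) ∷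
  (u 2 1 , cycle (u 1 0 ∷ u 2 1 ∷ u 3 0 ∷ u 2 0 ∷ []) ∷ cycle (u 0 1 ∷ u 1 0 ∷ u 2 1 ∷ u 1 1 ∷ []) ∷
     cycle (u 1 0 ∷ u 2 1 ∷ u 1 1 ∷ u 2 0 ∷ []) ∷ []) ∷
  (u 3 1 , cycle (u 2 0 ∷ u 3 1 ∷ u 4 0 ∷ u 3 0 ∷ []) ∷ cycle (u 1 1 ∷ u 2 0 ∷ u 3 1 ∷ u 2 1 ∷ []) ∷
     cycle (u 2 0 ∷ u 3 1 ∷ u 2 1 ∷ u 3 0 ∷ []) ∷ []) ∷
  (u 4 1 , cycle (u 3 0 ∷ u 4 1 ∷ u 3 1 ∷ u 4 0 ∷ []) ∷ cycle (u 0 0 ∷ u 1 1 ∷ u 0 1 ∷ u 4 1 ∷ []) ∷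
     cycle (u 0 0 ∷ u 4 0 ∷ u 3 0 ∷ u 4 1 ∷ []) ∷ cycle (u 0 1 ∷ u 4 1 ∷ u 3 1 ∷ u 4 0 ∷ []) ∷
     cycle (u 2 1 ∷ u 3 0 ∷ u 4 1 ∷ u 3 1 ∷ []) ∷ cycle (u 0 0 ∷ u 4 0 ∷ u 0 1 ∷ u 4 1 ∷ []) ∷
     cycle (u 0 1 ∷ u 4 1 ∷ u 3 1 ∷ u 2 1 ∷ u 1 1 ∷ []) ∷ []) ∷
  (u 0 2 , cycle (u 0 1 ∷ u 4 1 ∷ u 0 2 ∷ u 1 1 ∷ []) ∷ cycle (u 0 0 ∷ u 4 0 ∷ u 0 2 ∷ u 1 0 ∷ []) ∷
     cycle (u 0 2 ∷ u 1 0 ∷ u 2 1 ∷ u 3 0 ∷ u 4 1 ∷ []) ∷ cycle (u 0 2 ∷ u 1 1 ∷ u 2 0 ∷ u 3 1 ∷ u 4 0 ∷ []) ∷ []) ∷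
  (u 1 2 , cycle (u 0 1 ∷ u 1 2 ∷ u 2 1 ∷ u 1 1 ∷ []) ∷ cycle (u 0 0 ∷ u 1 2 ∷ u 0 2 ∷ u 1 0 ∷ []) ∷
     cycle (u 0 0 ∷ u 1 2 ∷ u 2 0 ∷ u 1 0 ∷ []) ∷ cycle (u 0 1 ∷ u 1 2 ∷ u 0 2 ∷ u 1 1 ∷ []) ∷
     cycle (u 0 0 ∷ u 1 2 ∷ u 2 1 ∷ u 3 0 ∷ u 4 1 ∷ []) ∷ cycle (u 0 1 ∷ u 1 2 ∷ u 2 0 ∷ u 3 1 ∷ u 4 0 ∷ []) ∷ []) ∷
  (u 2 2 , cycle (u 1 1 ∷ u 2 2 ∷ u 1 2 ∷ u 2 1 ∷ []) ∷ cycle (u 0 2 ∷ u 1 0 ∷ u 2 2 ∷ u 1 2 ∷ []) ∷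
     cycle (u 1 0 ∷ u 2 2 ∷ u 3 0 ∷ u 2 0 ∷ []) ∷ cycle (u 1 0 ∷ u 2 2 ∷ u 1 2 ∷ u 2 0 ∷ []) ∷
     cycle (u 1 1 ∷ u 2 2 ∷ u 3 1 ∷ u 2 1 ∷ []) ∷ cycle (u 0 2 ∷ u 1 1 ∷ u 2 2 ∷ u 1 2 ∷ []) ∷
     cycle (u 0 1 ∷ u 1 0 ∷ u 2 2 ∷ u 3 1 ∷ u 4 0 ∷ []) ∷ cycle (u 0 0 ∷ u 1 1 ∷ u 2 2 ∷ u 3 0 ∷ u 4 1 ∷ []) ∷
     cycle (u 0 2 ∷ u 1 0 ∷ u 2 2 ∷ u 3 0 ∷ u 4 1 ∷ []) ∷ cycle (u 0 2 ∷ u 1 0 ∷ u 2 2 ∷ u 3 1 ∷ u 4 0 ∷ []) ∷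
     cycle (u 0 2 ∷ u 1 1 ∷ u 2 2 ∷ u 3 0 ∷ u 4 1 ∷ []) ∷ cycle (u 0 2 ∷ u 1 1 ∷ u 2 2 ∷ u 3 1 ∷ u 4 0 ∷ []) ∷ []) ∷
  (u 3 2 , cycle (u 2 1 ∷ u 3 2 ∷ u 2 2 ∷ u 3 1 ∷ []) ∷ cycle (u 1 2 ∷ u 2 0 ∷ u 3 2 ∷ u 2 2 ∷ []) ∷
     cycle (u 0 2 ∷ u 1 1 ∷ u 2 0 ∷ u 3 2 ∷ u 4 0 ∷ []) ∷ cycle (u 0 2 ∷ u 1 0 ∷ u 2 1 ∷ u 3 2 ∷ u 4 1 ∷ []) ∷
     cycle (u 2 0 ∷ u 3 2 ∷ u 2 2 ∷ u 3 0 ∷ []) ∷ cycle (u 2 1 ∷ u 3 2 ∷ u 4 1 ∷ u 3 1 ∷ []) ∷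
     cycle (u 2 0 ∷ u 3 2 ∷ u 4 0 ∷ u 3 0 ∷ []) ∷ cycle (u 0 1 ∷ u 1 0 ∷ u 2 1 ∷ u 3 2 ∷ u 4 0 ∷ []) ∷
     cycle (u 0 2 ∷ u 1 0 ∷ u 2 1 ∷ u 3 2 ∷ u 4 0 ∷ []) ∷ cycle (u 0 2 ∷ u 1 1 ∷ u 2 0 ∷ u 3 2 ∷ u 4 1 ∷ []) ∷
     cycle (u 0 0 ∷ u 1 2 ∷ u 2 0 ∷ u 3 2 ∷ u 4 1 ∷ []) ∷ cycle (u 1 2 ∷ u 2 1 ∷ u 3 2 ∷ u 2 2 ∷ []) ∷
     cycle (u 0 0 ∷ u 1 1 ∷ u 2 0 ∷ u 3 2 ∷ u 4 1 ∷ []) ∷ cycle (u 0 1 ∷ u 1 2 ∷ u 2 1 ∷ u 3 2 ∷ u 4 0 ∷ []) ∷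
     cycle (u 0 1 ∷ u 1 2 ∷ u 2 0 ∷ u 3 2 ∷ u 4 0 ∷ []) ∷ cycle (u 0 0 ∷ u 1 2 ∷ u 2 1 ∷ u 3 2 ∷ u 4 1 ∷ []) ∷ []) ∷
  (u 4 2 , cycle (u 3 0 ∷ u 4 2 ∷ u 3 2 ∷ u 4 0 ∷ []) ∷ cycle (u 0 1 ∷ u 4 1 ∷ u 0 2 ∷ u 4 2 ∷ []) ∷
     cycle (u 3 1 ∷ u 4 2 ∷ u 3 2 ∷ u 4 1 ∷ []) ∷ cycle (u 0 0 ∷ u 4 0 ∷ u 0 2 ∷ u 4 2 ∷ []) ∷
     cycle (u 0 1 ∷ u 1 2 ∷ u 0 2 ∷ u 4 2 ∷ []) ∷ cycle (u 0 1 ∷ u 1 0 ∷ u 2 2 ∷ u 3 1 ∷ u 4 2 ∷ []) ∷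
     cycle (u 0 0 ∷ u 1 1 ∷ u 2 2 ∷ u 3 0 ∷ u 4 2 ∷ []) ∷ cycle (u 0 0 ∷ u 1 2 ∷ u 2 1 ∷ u 3 0 ∷ u 4 2 ∷ []) ∷
     cycle (u 0 0 ∷ u 1 2 ∷ u 2 0 ∷ u 3 1 ∷ u 4 2 ∷ []) ∷ cycle (u 0 0 ∷ u 1 1 ∷ u 2 2 ∷ u 3 1 ∷ u 4 2 ∷ []) ∷
     cycle (u 0 1 ∷ u 1 0 ∷ u 2 1 ∷ u 3 0 ∷ u 4 2 ∷ []) ∷ cycle (u 2 2 ∷ u 3 0 ∷ u 4 2 ∷ u 3 2 ∷ []) ∷
     cycle (u 0 1 ∷ u 4 1 ∷ u 3 1 ∷ u 4 2 ∷ []) ∷ cycle (u 0 0 ∷ u 1 1 ∷ u 2 0 ∷ u 3 1 ∷ u 4 2 ∷ []) ∷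
     cycle (u 0 0 ∷ u 4 0 ∷ u 3 0 ∷ u 4 2 ∷ []) ∷ cycle (u 0 1 ∷ u 1 2 ∷ u 2 1 ∷ u 3 0 ∷ u 4 2 ∷ []) ∷
     cycle (u 0 1 ∷ u 1 0 ∷ u 2 2 ∷ u 3 0 ∷ u 4 2 ∷ []) ∷ cycle (u 0 1 ∷ u 1 2 ∷ u 2 0 ∷ u 3 1 ∷ u 4 2 ∷ []) ∷
     cycle (u 0 2 ∷ u 4 2 ∷ u 3 2 ∷ u 4 0 ∷ []) ∷ cycle (u 2 2 ∷ u 3 1 ∷ u 4 2 ∷ u 3 2 ∷ []) ∷
     cycle (u 0 2 ∷ u 4 2 ∷ u 3 2 ∷ u 4 1 ∷ []) ∷ cycle (u 0 0 ∷ u 1 2 ∷ u 0 2 ∷ u 4 2 ∷ []) ∷ []) ∷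
  (u 0 3 , cycle (u 0 2 ∷ u 4 2 ∷ u 0 3 ∷ u 1 2 ∷ []) ∷ cycle (u 0 1 ∷ u 4 1 ∷ u 0 3 ∷ u 1 1 ∷ []) ∷
     cycle (u 0 0 ∷ u 4 0 ∷ u 0 3 ∷ u 1 0 ∷ []) ∷ cycle (u 0 3 ∷ u 1 1 ∷ u 2 2 ∷ u 3 0 ∷ u 4 1 ∷ []) ∷
     cycle (u 0 3 ∷ u 1 0 ∷ u 2 2 ∷ u 3 1 ∷ u 4 0 ∷ []) ∷ cycle (u 0 3 ∷ u 1 0 ∷ u 2 1 ∷ u 3 2 ∷ u 4 1 ∷ []) ∷
     cycle (u 0 3 ∷ u 1 1 ∷ u 2 0 ∷ u 3 2 ∷ u 4 0 ∷ []) ∷ cycle (u 0 3 ∷ u 1 2 ∷ u 2 1 ∷ u 3 0 ∷ u 4 2 ∷ []) ∷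
     cycle (u 0 3 ∷ u 1 2 ∷ u 2 0 ∷ u 3 1 ∷ u 4 0 ∷ []) ∷ cycle (u 0 3 ∷ u 1 1 ∷ u 2 0 ∷ u 3 2 ∷ u 4 1 ∷ []) ∷
     cycle (u 0 3 ∷ u 1 2 ∷ u 2 1 ∷ u 3 2 ∷ u 4 0 ∷ []) ∷ cycle (u 0 3 ∷ u 1 1 ∷ u 2 0 ∷ u 3 1 ∷ u 4 2 ∷ []) ∷
     cycle (u 0 3 ∷ u 1 0 ∷ u 2 1 ∷ u 3 2 ∷ u 4 0 ∷ []) ∷ cycle (u 0 3 ∷ u 1 2 ∷ u 2 0 ∷ u 3 1 ∷ u 4 2 ∷ []) ∷
     cycle (u 0 3 ∷ u 1 0 ∷ u 2 2 ∷ u 3 1 ∷ u 4 2 ∷ []) ∷ cycle (u 0 3 ∷ u 1 1 ∷ u 2 2 ∷ u 3 1 ∷ u 4 0 ∷ []) ∷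
     cycle (u 0 3 ∷ u 1 0 ∷ u 2 2 ∷ u 3 0 ∷ u 4 1 ∷ []) ∷ cycle (u 0 3 ∷ u 1 0 ∷ u 2 1 ∷ u 3 0 ∷ u 4 2 ∷ []) ∷
     cycle (u 0 3 ∷ u 1 2 ∷ u 2 0 ∷ u 3 2 ∷ u 4 1 ∷ []) ∷ cycle (u 0 3 ∷ u 1 2 ∷ u 2 1 ∷ u 3 0 ∷ u 4 1 ∷ []) ∷
     cycle (u 0 3 ∷ u 1 1 ∷ u 2 2 ∷ u 3 0 ∷ u 4 2 ∷ []) ∷ cycle (u 0 3 ∷ u 1 1 ∷ u 2 0 ∷ u 3 1 ∷ u 4 0 ∷ []) ∷ []) ∷
  (u 1 3 , cycle (u 0 0 ∷ u 1 3 ∷ u 0 3 ∷ u 1 0 ∷ []) ∷ cycle (u 0 2 ∷ u 1 3 ∷ u 0 3 ∷ u 1 2 ∷ []) ∷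
     cycle (u 0 1 ∷ u 1 3 ∷ u 0 3 ∷ u 1 1 ∷ []) ∷ cycle (u 0 2 ∷ u 1 3 ∷ u 2 2 ∷ u 3 0 ∷ u 4 1 ∷ []) ∷
     cycle (u 0 1 ∷ u 1 3 ∷ u 2 1 ∷ u 3 0 ∷ u 4 2 ∷ []) ∷ cycle (u 0 0 ∷ u 1 3 ∷ u 2 1 ∷ u 3 2 ∷ u 4 1 ∷ []) ∷
     cycle (u 0 0 ∷ u 1 3 ∷ u 2 2 ∷ u 3 1 ∷ u 4 2 ∷ []) ∷ cycle (u 0 2 ∷ u 1 3 ∷ u 2 1 ∷ u 3 2 ∷ u 4 0 ∷ []) ∷
     cycle (u 0 1 ∷ u 1 3 ∷ u 2 2 ∷ u 3 1 ∷ u 4 0 ∷ []) ∷ cycle (u 0 1 ∷ u 1 3 ∷ u 2 0 ∷ u 3 2 ∷ u 4 0 ∷ []) ∷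
     cycle (u 0 2 ∷ u 1 3 ∷ u 2 0 ∷ u 3 1 ∷ u 4 0 ∷ []) ∷ cycle (u 0 0 ∷ u 1 3 ∷ u 2 0 ∷ u 3 1 ∷ u 4 2 ∷ []) ∷
     cycle (u 0 0 ∷ u 1 3 ∷ u 2 0 ∷ u 3 2 ∷ u 4 1 ∷ []) ∷ cycle (u 0 2 ∷ u 1 3 ∷ u 2 1 ∷ u 3 0 ∷ u 4 1 ∷ []) ∷
     cycle (u 0 1 ∷ u 1 3 ∷ u 2 2 ∷ u 3 0 ∷ u 4 2 ∷ []) ∷ cycle (u 0 1 ∷ u 1 3 ∷ u 2 1 ∷ u 3 2 ∷ u 4 0 ∷ []) ∷
     cycle (u 0 2 ∷ u 1 3 ∷ u 2 2 ∷ u 3 1 ∷ u 4 0 ∷ []) ∷ cycle (u 0 0 ∷ u 1 3 ∷ u 2 0 ∷ u 1 0 ∷ []) ∷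
     cycle (u 0 2 ∷ u 1 3 ∷ u 2 2 ∷ u 1 2 ∷ []) ∷ cycle (u 0 1 ∷ u 1 3 ∷ u 2 1 ∷ u 1 1 ∷ []) ∷
     cycle (u 0 0 ∷ u 1 3 ∷ u 2 2 ∷ u 3 0 ∷ u 4 1 ∷ []) ∷ cycle (u 0 0 ∷ u 1 3 ∷ u 2 1 ∷ u 3 0 ∷ u 4 2 ∷ []) ∷
     cycle (u 0 2 ∷ u 1 3 ∷ u 2 0 ∷ u 3 2 ∷ u 4 1 ∷ []) ∷ cycle (u 0 1 ∷ u 1 3 ∷ u 2 0 ∷ u 3 1 ∷ u 4 2 ∷ []) ∷ []) ∷
  (u 2 3 , cycle (u 1 2 ∷ u 2 3 ∷ u 1 3 ∷ u 2 2 ∷ []) ∷ cycle (u 1 1 ∷ u 2 3 ∷ u 1 3 ∷ u 2 1 ∷ []) ∷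
     cycle (u 1 0 ∷ u 2 3 ∷ u 1 3 ∷ u 2 0 ∷ []) ∷ cycle (u 0 2 ∷ u 1 1 ∷ u 2 3 ∷ u 3 1 ∷ u 4 0 ∷ []) ∷
     cycle (u 0 3 ∷ u 1 0 ∷ u 2 3 ∷ u 3 1 ∷ u 4 2 ∷ []) ∷ cycle (u 0 1 ∷ u 1 2 ∷ u 2 3 ∷ u 3 1 ∷ u 4 0 ∷ []) ∷
     cycle (u 0 3 ∷ u 1 0 ∷ u 2 3 ∷ u 3 2 ∷ u 4 1 ∷ []) ∷ cycle (u 0 0 ∷ u 1 2 ∷ u 2 3 ∷ u 3 0 ∷ u 4 1 ∷ []) ∷
     cycle (u 0 0 ∷ u 1 1 ∷ u 2 3 ∷ u 3 0 ∷ u 4 2 ∷ []) ∷ cycle (u 0 2 ∷ u 1 0 ∷ u 2 3 ∷ u 3 2 ∷ u 4 1 ∷ []) ∷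
     cycle (u 0 1 ∷ u 1 0 ∷ u 2 3 ∷ u 3 1 ∷ u 4 2 ∷ []) ∷ cycle (u 0 3 ∷ u 1 1 ∷ u 2 3 ∷ u 3 2 ∷ u 4 0 ∷ []) ∷
     cycle (u 0 3 ∷ u 1 2 ∷ u 2 3 ∷ u 3 0 ∷ u 4 1 ∷ []) ∷ cycle (u 0 3 ∷ u 1 1 ∷ u 2 3 ∷ u 3 0 ∷ u 4 2 ∷ []) ∷
     cycle (u 1 2 ∷ u 2 3 ∷ u 3 2 ∷ u 2 2 ∷ []) ∷ cycle (u 0 3 ∷ u 1 2 ∷ u 2 3 ∷ u 3 1 ∷ u 4 0 ∷ []) ∷
     cycle (u 1 1 ∷ u 2 3 ∷ u 3 1 ∷ u 2 1 ∷ []) ∷ cycle (u 0 3 ∷ u 1 0 ∷ u 2 3 ∷ u 1 3 ∷ []) ∷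
     cycle (u 1 0 ∷ u 2 3 ∷ u 3 0 ∷ u 2 0 ∷ []) ∷ cycle (u 0 3 ∷ u 1 1 ∷ u 2 3 ∷ u 1 3 ∷ []) ∷
     cycle (u 0 3 ∷ u 1 2 ∷ u 2 3 ∷ u 1 3 ∷ []) ∷ cycle (u 0 2 ∷ u 1 0 ∷ u 2 3 ∷ u 3 0 ∷ u 4 1 ∷ []) ∷
     cycle (u 0 1 ∷ u 1 0 ∷ u 2 3 ∷ u 3 0 ∷ u 4 2 ∷ []) ∷ cycle (u 0 0 ∷ u 1 1 ∷ u 2 3 ∷ u 3 2 ∷ u 4 1 ∷ []) ∷
     cycle (u 0 0 ∷ u 1 1 ∷ u 2 3 ∷ u 3 1 ∷ u 4 2 ∷ []) ∷ cycle (u 0 1 ∷ u 1 0 ∷ u 2 3 ∷ u 3 2 ∷ u 4 0 ∷ []) ∷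
     cycle (u 0 2 ∷ u 1 1 ∷ u 2 3 ∷ u 3 2 ∷ u 4 0 ∷ []) ∷ []) ∷
  (u 3 3 , cycle (u 2 1 ∷ u 3 3 ∷ u 2 3 ∷ u 3 1 ∷ []) ∷ cycle (u 2 2 ∷ u 3 3 ∷ u 2 3 ∷ u 3 2 ∷ []) ∷
     cycle (u 2 0 ∷ u 3 3 ∷ u 2 3 ∷ u 3 0 ∷ []) ∷ cycle (u 0 3 ∷ u 1 1 ∷ u 2 0 ∷ u 3 3 ∷ u 4 0 ∷ []) ∷
     cycle (u 0 3 ∷ u 1 0 ∷ u 2 1 ∷ u 3 3 ∷ u 4 0 ∷ []) ∷ cycle (u 0 0 ∷ u 1 2 ∷ u 2 1 ∷ u 3 3 ∷ u 4 2 ∷ []) ∷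
     cycle (u 0 1 ∷ u 1 2 ∷ u 2 0 ∷ u 3 3 ∷ u 4 0 ∷ []) ∷ cycle (u 1 3 ∷ u 2 0 ∷ u 3 3 ∷ u 2 3 ∷ []) ∷
     cycle (u 0 0 ∷ u 1 1 ∷ u 2 2 ∷ u 3 3 ∷ u 4 1 ∷ []) ∷ cycle (u 0 2 ∷ u 1 0 ∷ u 2 1 ∷ u 3 3 ∷ u 4 1 ∷ []) ∷
     cycle (u 0 1 ∷ u 1 0 ∷ u 2 1 ∷ u 3 3 ∷ u 4 2 ∷ []) ∷ cycle (u 0 2 ∷ u 1 1 ∷ u 2 0 ∷ u 3 3 ∷ u 4 0 ∷ []) ∷
     cycle (u 0 1 ∷ u 1 0 ∷ u 2 2 ∷ u 3 3 ∷ u 4 0 ∷ []) ∷ cycle (u 0 2 ∷ u 1 0 ∷ u 2 1 ∷ u 3 3 ∷ u 4 0 ∷ []) ∷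
     cycle (u 0 2 ∷ u 1 1 ∷ u 2 0 ∷ u 3 3 ∷ u 4 1 ∷ []) ∷ cycle (u 0 1 ∷ u 1 2 ∷ u 2 0 ∷ u 3 3 ∷ u 4 2 ∷ []) ∷
     cycle (u 2 0 ∷ u 3 3 ∷ u 4 0 ∷ u 3 0 ∷ []) ∷ cycle (u 1 3 ∷ u 2 1 ∷ u 3 3 ∷ u 2 3 ∷ []) ∷
     cycle (u 2 1 ∷ u 3 3 ∷ u 4 1 ∷ u 3 1 ∷ []) ∷ cycle (u 1 3 ∷ u 2 2 ∷ u 3 3 ∷ u 2 3 ∷ []) ∷
     cycle (u 2 2 ∷ u 3 3 ∷ u 4 2 ∷ u 3 2 ∷ []) ∷ cycle (u 0 0 ∷ u 1 2 ∷ u 2 0 ∷ u 3 3 ∷ u 4 1 ∷ []) ∷ []) ∷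
  (u 4 3 , cycle (u 3 0 ∷ u 4 3 ∷ u 3 3 ∷ u 4 0 ∷ []) ∷ cycle (u 0 1 ∷ u 4 1 ∷ u 0 3 ∷ u 4 3 ∷ []) ∷
     cycle (u 0 2 ∷ u 4 2 ∷ u 0 3 ∷ u 4 3 ∷ []) ∷ cycle (u 3 2 ∷ u 4 3 ∷ u 3 3 ∷ u 4 2 ∷ []) ∷
     cycle (u 3 1 ∷ u 4 3 ∷ u 3 3 ∷ u 4 1 ∷ []) ∷ cycle (u 0 0 ∷ u 4 0 ∷ u 0 3 ∷ u 4 3 ∷ []) ∷
     cycle (u 0 0 ∷ u 1 3 ∷ u 0 3 ∷ u 4 3 ∷ []) ∷ cycle (u 0 0 ∷ u 1 1 ∷ u 2 3 ∷ u 3 0 ∷ u 4 3 ∷ []) ∷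
     cycle (u 0 1 ∷ u 1 0 ∷ u 2 1 ∷ u 3 2 ∷ u 4 3 ∷ []) ∷ cycle (u 0 1 ∷ u 1 0 ∷ u 2 2 ∷ u 3 1 ∷ u 4 3 ∷ []) ∷
     cycle (u 0 0 ∷ u 1 1 ∷ u 2 0 ∷ u 3 1 ∷ u 4 3 ∷ []) ∷ cycle (u 0 0 ∷ u 1 2 ∷ u 2 3 ∷ u 3 0 ∷ u 4 3 ∷ []) ∷
     cycle (u 0 0 ∷ u 1 2 ∷ u 2 0 ∷ u 3 2 ∷ u 4 3 ∷ []) ∷ cycle (u 0 1 ∷ u 1 0 ∷ u 2 3 ∷ u 3 0 ∷ u 4 3 ∷ []) ∷
     cycle (u 0 0 ∷ u 1 3 ∷ u 2 1 ∷ u 3 0 ∷ u 4 3 ∷ []) ∷ cycle (u 0 0 ∷ u 1 1 ∷ u 2 2 ∷ u 3 0 ∷ u 4 3 ∷ []) ∷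
     cycle (u 0 1 ∷ u 1 3 ∷ u 2 0 ∷ u 3 1 ∷ u 4 3 ∷ []) ∷ cycle (u 0 1 ∷ u 1 2 ∷ u 2 0 ∷ u 3 1 ∷ u 4 3 ∷ []) ∷ []) ∷
  (u 0 4 , cycle (u 0 4 ∷ u 1 0 ∷ u 2 1 ∷ u 3 0 ∷ u 4 1 ∷ []) ∷
     cycle (u 0 4 ∷ u 1 1 ∷ u 2 0 ∷ u 3 3 ∷ u 4 0 ∷ []) ∷ cycle (u 0 4 ∷ u 1 0 ∷ u 2 2 ∷ u 3 1 ∷ u 4 0 ∷ []) ∷
     cycle (u 0 4 ∷ u 1 0 ∷ u 2 2 ∷ u 3 0 ∷ u 4 1 ∷ []) ∷ cycle (u 0 4 ∷ u 1 1 ∷ u 2 0 ∷ u 3 2 ∷ u 4 0 ∷ []) ∷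
     cycle (u 0 4 ∷ u 1 0 ∷ u 2 1 ∷ u 3 3 ∷ u 4 0 ∷ []) ∷ cycle (u 0 4 ∷ u 1 0 ∷ u 2 3 ∷ u 3 1 ∷ u 4 0 ∷ []) ∷
     cycle (u 0 4 ∷ u 1 0 ∷ u 2 1 ∷ u 3 2 ∷ u 4 0 ∷ []) ∷ cycle (u 0 4 ∷ u 1 0 ∷ u 2 3 ∷ u 3 0 ∷ u 4 1 ∷ []) ∷
     cycle (u 0 4 ∷ u 1 1 ∷ u 2 0 ∷ u 3 1 ∷ u 4 0 ∷ []) ∷ []) ∷
  (u 1 4 , cycle (u 0 0 ∷ u 1 4 ∷ u 0 4 ∷ u 1 0 ∷ []) ∷ cycle (u 0 1 ∷ u 1 4 ∷ u 0 4 ∷ u 1 1 ∷ []) ∷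
     cycle (u 0 3 ∷ u 1 4 ∷ u 0 4 ∷ u 1 3 ∷ []) ∷ cycle (u 0 2 ∷ u 1 4 ∷ u 0 4 ∷ u 1 2 ∷ []) ∷
     cycle (u 0 1 ∷ u 1 4 ∷ u 2 0 ∷ u 3 1 ∷ u 4 0 ∷ []) ∷ cycle (u 0 0 ∷ u 1 4 ∷ u 2 1 ∷ u 3 0 ∷ u 4 1 ∷ []) ∷
     cycle (u 0 1 ∷ u 1 4 ∷ u 2 0 ∷ u 3 2 ∷ u 4 0 ∷ []) ∷ cycle (u 0 0 ∷ u 1 4 ∷ u 2 0 ∷ u 3 3 ∷ u 4 1 ∷ []) ∷
     cycle (u 0 0 ∷ u 1 4 ∷ u 2 0 ∷ u 3 1 ∷ u 4 2 ∷ []) ∷ cycle (u 0 0 ∷ u 1 4 ∷ u 2 1 ∷ u 3 0 ∷ u 4 2 ∷ []) ∷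
     cycle (u 0 0 ∷ u 1 4 ∷ u 2 0 ∷ u 3 2 ∷ u 4 1 ∷ []) ∷ cycle (u 0 1 ∷ u 1 4 ∷ u 2 0 ∷ u 3 3 ∷ u 4 0 ∷ []) ∷
     cycle (u 0 0 ∷ u 1 4 ∷ u 2 0 ∷ u 3 1 ∷ u 4 3 ∷ []) ∷ cycle (u 0 0 ∷ u 1 4 ∷ u 2 1 ∷ u 3 0 ∷ u 4 3 ∷ []) ∷
     cycle (u 0 0 ∷ u 1 4 ∷ u 2 0 ∷ u 3 3 ∷ u 4 2 ∷ []) ∷ cycle (u 0 0 ∷ u 1 4 ∷ u 2 0 ∷ u 3 2 ∷ u 4 3 ∷ []) ∷ []) ∷
  (u 2 4 , cycle (u 1 3 ∷ u 2 4 ∷ u 1 4 ∷ u 2 3 ∷ []) ∷ cycle (u 1 2 ∷ u 2 4 ∷ u 1 4 ∷ u 2 2 ∷ []) ∷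
     cycle (u 1 1 ∷ u 2 4 ∷ u 1 4 ∷ u 2 1 ∷ []) ∷ cycle (u 1 0 ∷ u 2 4 ∷ u 1 4 ∷ u 2 0 ∷ []) ∷
     cycle (u 0 0 ∷ u 1 1 ∷ u 2 4 ∷ u 3 0 ∷ u 4 1 ∷ []) ∷ cycle (u 0 3 ∷ u 1 0 ∷ u 2 4 ∷ u 3 1 ∷ u 4 0 ∷ []) ∷
     cycle (u 0 0 ∷ u 1 2 ∷ u 2 4 ∷ u 3 0 ∷ u 4 2 ∷ []) ∷ cycle (u 0 0 ∷ u 1 1 ∷ u 2 4 ∷ u 3 0 ∷ u 4 3 ∷ []) ∷
     cycle (u 0 2 ∷ u 1 0 ∷ u 2 4 ∷ u 3 1 ∷ u 4 0 ∷ []) ∷ cycle (u 0 3 ∷ u 1 0 ∷ u 2 4 ∷ u 3 0 ∷ u 4 1 ∷ []) ∷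
     cycle (u 0 1 ∷ u 1 0 ∷ u 2 4 ∷ u 3 0 ∷ u 4 2 ∷ []) ∷ cycle (u 0 1 ∷ u 1 0 ∷ u 2 4 ∷ u 3 0 ∷ u 4 3 ∷ []) ∷
     cycle (u 0 2 ∷ u 1 0 ∷ u 2 4 ∷ u 3 0 ∷ u 4 1 ∷ []) ∷ cycle (u 0 1 ∷ u 1 0 ∷ u 2 4 ∷ u 3 1 ∷ u 4 0 ∷ []) ∷
     cycle (u 0 0 ∷ u 1 2 ∷ u 2 4 ∷ u 3 0 ∷ u 4 3 ∷ []) ∷ []) ∷
  (u 3 4 , cycle (u 2 1 ∷ u 3 4 ∷ u 2 4 ∷ u 3 1 ∷ []) ∷ cycle (u 2 2 ∷ u 3 4 ∷ u 2 4 ∷ u 3 2 ∷ []) ∷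
     cycle (u 2 3 ∷ u 3 4 ∷ u 2 4 ∷ u 3 3 ∷ []) ∷ cycle (u 2 0 ∷ u 3 4 ∷ u 2 4 ∷ u 3 0 ∷ []) ∷
     cycle (u 0 0 ∷ u 1 1 ∷ u 2 0 ∷ u 3 4 ∷ u 4 1 ∷ []) ∷ cycle (u 0 1 ∷ u 1 0 ∷ u 2 1 ∷ u 3 4 ∷ u 4 0 ∷ []) ∷
     cycle (u 0 3 ∷ u 1 0 ∷ u 2 1 ∷ u 3 4 ∷ u 4 0 ∷ []) ∷ cycle (u 0 3 ∷ u 1 1 ∷ u 2 0 ∷ u 3 4 ∷ u 4 0 ∷ []) ∷
     cycle (u 0 2 ∷ u 1 1 ∷ u 2 0 ∷ u 3 4 ∷ u 4 0 ∷ []) ∷ cycle (u 0 2 ∷ u 1 0 ∷ u 2 1 ∷ u 3 4 ∷ u 4 0 ∷ []) ∷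
     cycle (u 0 1 ∷ u 1 2 ∷ u 2 0 ∷ u 3 4 ∷ u 4 0 ∷ []) ∷ cycle (u 0 0 ∷ u 1 2 ∷ u 2 0 ∷ u 3 4 ∷ u 4 1 ∷ []) ∷
     cycle (u 0 1 ∷ u 1 3 ∷ u 2 0 ∷ u 3 4 ∷ u 4 0 ∷ []) ∷ cycle (u 0 0 ∷ u 1 3 ∷ u 2 0 ∷ u 3 4 ∷ u 4 1 ∷ []) ∷ []) ∷
  (u 4 4 , cycle (u 3 2 ∷ u 4 4 ∷ u 3 4 ∷ u 4 2 ∷ []) ∷ cycle (u 3 3 ∷ u 4 4 ∷ u 3 4 ∷ u 4 3 ∷ []) ∷
     cycle (u 0 3 ∷ u 4 3 ∷ u 0 4 ∷ u 4 4 ∷ []) ∷ cycle (u 0 2 ∷ u 4 2 ∷ u 0 4 ∷ u 4 4 ∷ []) ∷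
     cycle (u 3 1 ∷ u 4 4 ∷ u 3 4 ∷ u 4 1 ∷ []) ∷ cycle (u 0 1 ∷ u 4 1 ∷ u 0 4 ∷ u 4 4 ∷ []) ∷
     cycle (u 0 0 ∷ u 4 0 ∷ u 0 4 ∷ u 4 4 ∷ []) ∷ cycle (u 3 0 ∷ u 4 4 ∷ u 3 4 ∷ u 4 0 ∷ []) ∷
     cycle (u 0 1 ∷ u 1 0 ∷ u 2 1 ∷ u 3 0 ∷ u 4 4 ∷ []) ∷ cycle (u 0 0 ∷ u 1 2 ∷ u 2 0 ∷ u 3 2 ∷ u 4 4 ∷ []) ∷
     cycle (u 0 0 ∷ u 1 1 ∷ u 2 2 ∷ u 3 0 ∷ u 4 4 ∷ []) ∷ cycle (u 0 0 ∷ u 1 1 ∷ u 2 0 ∷ u 3 1 ∷ u 4 4 ∷ []) ∷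
     cycle (u 0 1 ∷ u 1 0 ∷ u 2 2 ∷ u 3 0 ∷ u 4 4 ∷ []) ∷ cycle (u 0 0 ∷ u 1 1 ∷ u 2 3 ∷ u 3 0 ∷ u 4 4 ∷ []) ∷
     cycle (u 0 0 ∷ u 1 2 ∷ u 2 1 ∷ u 3 0 ∷ u 4 4 ∷ []) ∷ cycle (u 0 0 ∷ u 1 3 ∷ u 2 0 ∷ u 3 1 ∷ u 4 4 ∷ []) ∷
     cycle (u 0 1 ∷ u 1 0 ∷ u 2 3 ∷ u 3 0 ∷ u 4 4 ∷ []) ∷ cycle (u 0 0 ∷ u 1 3 ∷ u 2 1 ∷ u 3 0 ∷ u 4 4 ∷ []) ∷
     cycle (u 0 0 ∷ u 1 2 ∷ u 2 3 ∷ u 3 0 ∷ u 4 4 ∷ []) ∷ cycle (u 0 0 ∷ u 1 3 ∷ u 2 0 ∷ u 3 2 ∷ u 4 4 ∷ []) ∷ []) ∷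
  []

every-2-colouring-has-monochromatic-cycle : ∀ (f : Vertex → Fin 2) → ∃ λ C → Monochromatic f C
every-2-colouring-has-monochromatic-cycle f = refutes-sound plan unassigned _ f (extends-unassigned f)

¬2-dicolourable : ¬ Dicolourable 2 D25
¬2-dicolourable (f , acyclic) =
  let (C , mono) = every-2-colouring-has-monochromatic-cycle f
  in monochromatic⇒¬dicolouring f C mono acyclic

mainTheorem14 : Dicritical 3 D25 × Oriented D25 × TriangleFree D25 × V D25 ≡ (Fin 5 × Fin 5)
mainTheorem14 =
  ( (ranked⇒dicolourable three-colouring , ¬2-dicolourable)
  , proper-subdigraphs-dicolourable out-arc colouring-without-arc )
  , oriented , triangle-free , refl
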